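{- Let $G=(V,E)$ be a graph with $n=|V|$ and let $\pi$ be a 2-partition of $V$ such that $h_2(\pi)\le h_2(\pi\ominus\{v\})$ for every vertex $v\in V$. Then $c_\pi(v)\le\sqrt{n(n-1)/2}$ for every $v\in V$.
   Context: A 2-partition of $V$ is an unordered pair $\pi=(V_1,V_2)$ with $V_1\cap V_2=\emptyset$, $V_1\cup V_2=V$ (clusters may be empty). Two distinct vertices $u,v$ are in conflict in $\pi$ if they are in the same cluster and $(u,v)\notin E$, or in different clusters and $(u,v)\in E$; $c_\pi(v)$ is the number of vertices in conflict with $v$, and $h_2(\pi)=\sum_{v\in V}c_\pi(v)^2$. For $F\subseteq V$, $\pi\ominus F=(V_1\ominus F,V_2\ominus F)$ ($\ominus$ = symmetric difference), i.e. the vertices of $F$ are moved to the other cluster. -}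

module Defs where

open import Data.Nat using (ℕ; zero; suc; _+_; _*_)
open import Data.Bool using (Bool; true; false; not; if_then_else_; _∧_)
open import Data.Fin using (Fin)
open import Data.Fin.Properties using (_≟_)
open import Data.List using (List; map; filterᵇ; length)
open import Data.Nat.ListAction using (sum)
open import Data.List using () renaming (allFin to allFinL)
open import Relation.Nullary using (¬_; does)
open import Relation.Binary.PropositionalEquality using (_≡_)

record Graph (n : ℕ) : Set where
  field
    adj   : Fin n → Fin n → Bool
    sym   : ∀ u v → adj u v ≡ adj v u
    irref : ∀ v → adj v v ≡ false
open Graph public

-- A 2-partition (V₁,V₂) of V, encoded by the side of each vertex
-- (true ↦ V₁, false ↦ V₂). Clusters may be empty. The unordered pair
-- corresponds to the labeling up to swapping true/false; all notions
-- below are invariant under that swap.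
Partition : ℕ → Set
Partition n = Fin n → Bool

_==ᵇ_ : Bool → Bool → Bool
true  ==ᵇ b = b
false ==ᵇ b = not b

-- u,v conflict in π: distinct, and (same cluster ∧ non-adjacent) or
-- (different clusters ∧ adjacent).
conflict : ∀ {n} → Graph n → Partition n → Fin n → Fin n → Bool
conflict G π u v =
  not (does (u ≟ v)) ∧ ((π u ==ᵇ π v) ==ᵇ not (adj G u v))

c : ∀ {n} → Graph n → Partition n → Fin n → ℕ
c {n} G π v = length (filterᵇ (conflict G π v) (allFinL n))

h₂ : ∀ {n} → Graph n → Partition n → ℕ
h₂ {n} G π = sum (map (λ v → c G π v * c G π v) (allFinL n))

flip1 : ∀ {n} → Partition n → Fin n → Partition n
flip1 π v u = if does (u ≟ v) then not (π u) else π u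

module Submission where

-- Fix v and let π′ = π ⊖ {v}.  Split V ∖ {v} into A, the vertices in
-- conflict with v under π (|A| = c = c_π(v)), and B, those in conflict with
-- v under π′ (|B| = m = c_π′(v)); so c + m + 1 = n.  Flipping v toggles
-- exactly the pairs {u, v}, hence c_π′(u) = c_π(u) - 1 on A and c_π(u) + 1 on
-- B, and expanding the squares gives the energy identity
--   h₂(π′) + 2·Σ_{u∈A} c(u) + c² = h₂(π) + c + (2·Σ_{u∈B} c(u) + m) + m².
-- Splitting the conflicts of each u along A, B and {v}, and writing X for
-- the number of conflicting pairs between A and B (counted from either side),
--   Σ_{u∈A} c(u) ≥ c + X      and      Σ_{u∈B} c(u) ≤ X + m².
-- With h₂(π) ≤ h₂(π′) this gives c² + c ≤ 3m² + m, so c ≤ 2m, and finally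
-- 2c² ≤ (c + m)² ≤ n(n-1).

open import Defs hiding (sym)
open import Data.Nat using (ℕ; zero; suc; _+_; _*_; _≤_; _<_; _∸_; z≤n; s≤s; _≤?_)
open import Data.Nat.Properties
  using (+-identityʳ; +-comm; +-mono-≤; +-monoˡ-≤; +-monoʳ-≤; +-cancelˡ-≤; *-mono-≤;
         *-monoʳ-≤; *-monoˡ-≤; *-identityˡ; *-identityʳ; *-comm; m≤m+n; m≤n+m; n≤1+n;
         <-≤-trans; <⇒≱; ≰⇒>; +-*-semiring; *-commutativeSemigroup; module ≤-Reasoning)
open import Data.Nat.Tactic.RingSolver using (solve-∀)
open import Algebra.Properties.CommutativeSemigroup *-commutativeSemigroup using (x∙yz≈y∙xz)
open import Data.Bool using (Bool; true; false; not; if_then_else_; _∧_; _xor_)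
open import Data.Bool.Properties using (not-involutive)
open import Data.Fin using (Fin; zero; suc)
open import Data.Fin.Properties using (_≟_)
open import Data.List using (map; filterᵇ; length; tabulate)
open import Data.Nat.ListAction using (sum)
open import Data.Empty using (⊥-elim)
open import Function using (_∘_; id; case_of_)
open import Relation.Nullary using (does; yes; no)
open import Relation.Nullary.Decidable using (dec-true; dec-false)
open import Relation.Binary.PropositionalEquality
  using (_≡_; _≢_; refl; sym; trans; cong; cong₂; subst; ≢-sym; module ≡-Reasoning)
open import Algebra.Properties.Semiring.Sum +-*-semiring
  using (sum-syntax; ∑-distrib-+; ∑-comm; *-distribˡ-sum; *-distribʳ-sum;
         sum-cong-≗; sum-replicate-zero)

⟦_⟧ : Bool → ℕ
⟦ true ⟧  = 1
⟦ false ⟧ = 0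

⟦⟧≤1 : ∀ b → ⟦ b ⟧ ≤ 1
⟦⟧≤1 true  = s≤s z≤n
⟦⟧≤1 false = z≤n

⟦⟧-complement : ∀ b → ⟦ b ⟧ + ⟦ not b ⟧ ≡ 1
⟦⟧-complement true  = refl
⟦⟧-complement false = refl

⟦⟧-disjoint : ∀ b → ⟦ b ⟧ * ⟦ not b ⟧ ≡ 0
⟦⟧-disjoint true  = refl
⟦⟧-disjoint false = refl

length-filter-tabulate : ∀ {A : Set} {n} (p : A → Bool) (f : Fin n → A) →
                         length (filterᵇ p (tabulate f)) ≡ ∑[ i < n ] ⟦ p (f i) ⟧
length-filter-tabulate {n = zero}  p f = refl
length-filter-tabulate {n = suc n} p f with p (f zero)
... | true  = cong suc (length-filter-tabulate p (f ∘ suc))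
... | false = length-filter-tabulate p (f ∘ suc)

sum-map-tabulate : ∀ {A : Set} {n} (g : A → ℕ) (f : Fin n → A) →
                   sum (map g (tabulate f)) ≡ ∑[ i < n ] g (f i)
sum-map-tabulate {n = zero}  g f = refl
sum-map-tabulate {n = suc n} g f = cong (g (f zero) +_) (sum-map-tabulate g (f ∘ suc))

∑-mono-≤ : ∀ {n} {f g : Fin n → ℕ} → (∀ i → f i ≤ g i) → ∑[ i < n ] f i ≤ ∑[ i < n ] g i
∑-mono-≤ {zero}  f≤g = z≤n
∑-mono-≤ {suc n} f≤g = +-mono-≤ (f≤g zero) (∑-mono-≤ (f≤g ∘ suc))

∑-distrib-+₃ : ∀ {n} (f g h : Fin n → ℕ) →
               ∑[ i < n ] (f i + g i + h i) ≡ ∑[ i < n ] f i + ∑[ i < n ] g i + ∑[ i < n ] h i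
∑-distrib-+₃ f g h = trans (∑-distrib-+ _ h) (cong (_+ ∑[ i < _ ] h i) (∑-distrib-+ f g))

∑-ones : ∀ n → ∑[ i < n ] 1 ≡ n
∑-ones zero    = refl
∑-ones (suc n) = cong suc (∑-ones n)

∑-pick : ∀ {n} (v : Fin n) (g : Fin n → ℕ) → ∑[ u < n ] (⟦ does (u ≟ v) ⟧ * g u) ≡ g v
∑-pick {suc n} zero    g = trans (cong₂ _+_ (+-identityʳ (g zero)) (sum-replicate-zero n))
                                 (+-identityʳ (g zero))
∑-pick {suc n} (suc v) g = ∑-pick v (g ∘ suc)

∑-≤-weights : ∀ {n} (w : Fin n → ℕ) (b : Fin n → Bool) →
              ∑[ i < n ] (w i * ⟦ b i ⟧) ≤ ∑[ i < n ] w i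
∑-≤-weights w b = ∑-mono-≤ (λ i → subst (w i * ⟦ b i ⟧ ≤_) (*-identityʳ (w i)) (*-monoʳ-≤ (w i) (⟦⟧≤1 (b i))))

∑-toggle : ∀ {n} (v : Fin n) (f : Fin n → Bool) →
           ∑[ w < n ] ⟦ does (w ≟ v) xor f w ⟧ + ⟦ f v ⟧ ≡ ∑[ w < n ] ⟦ f w ⟧ + ⟦ not (f v) ⟧
∑-toggle {n} v f = begin
    ∑[ w < n ] ⟦ d w xor f w ⟧ + ⟦ f v ⟧
  ≡⟨ cong (∑[ w < n ] ⟦ d w xor f w ⟧ +_) (sym (∑-pick v (⟦_⟧ ∘ f))) ⟩
    ∑[ w < n ] ⟦ d w xor f w ⟧ + ∑[ w < n ] (⟦ d w ⟧ * ⟦ f w ⟧)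
  ≡⟨ sym (∑-distrib-+ (λ w → ⟦ d w xor f w ⟧) (λ w → ⟦ d w ⟧ * ⟦ f w ⟧)) ⟩
    ∑[ w < n ] (⟦ d w xor f w ⟧ + ⟦ d w ⟧ * ⟦ f w ⟧)
  ≡⟨ sum-cong-≗ (λ w → toggle (d w) (f w)) ⟩
    ∑[ w < n ] (⟦ f w ⟧ + ⟦ d w ⟧ * ⟦ not (f w) ⟧)
  ≡⟨ ∑-distrib-+ (⟦_⟧ ∘ f) (λ w → ⟦ d w ⟧ * ⟦ not (f w) ⟧) ⟩
    ∑[ w < n ] ⟦ f w ⟧ + ∑[ w < n ] (⟦ d w ⟧ * ⟦ not (f w) ⟧)
  ≡⟨ cong (∑[ w < n ] ⟦ f w ⟧ +_) (∑-pick v (⟦_⟧ ∘ not ∘ f)) ⟩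
    ∑[ w < n ] ⟦ f w ⟧ + ⟦ not (f v) ⟧ ∎
  where
  open ≡-Reasoning
  d : Fin n → Bool
  d w = does (w ≟ v)
  toggle : ∀ t b → ⟦ t xor b ⟧ + ⟦ t ⟧ * ⟦ b ⟧ ≡ ⟦ b ⟧ + ⟦ t ⟧ * ⟦ not b ⟧
  toggle true  true  = refl
  toggle true  false = refl
  toggle false b     = refl

==ᵇ-comm : ∀ p q → (p ==ᵇ q) ≡ (q ==ᵇ p)
==ᵇ-comm true  true  = refl
==ᵇ-comm true  false = refl
==ᵇ-comm false true  = refl
==ᵇ-comm false false = refl

==ᵇ-notˡ : ∀ p q → (not p ==ᵇ q) ≡ not (p ==ᵇ q)
==ᵇ-notˡ true  q = refl
==ᵇ-notˡ false q = sym (not-involutive q)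

==ᵇ-notʳ : ∀ p q → (p ==ᵇ not q) ≡ not (p ==ᵇ q)
==ᵇ-notʳ true  q = refl
==ᵇ-notʳ false q = refl

does-≟-sym : ∀ {n} (u w : Fin n) → does (u ≟ w) ≡ does (w ≟ u)
does-≟-sym u w with u ≟ w
... | yes refl = sym (dec-true (u ≟ u) refl)
... | no u≢w   = sym (dec-false (w ≟ u) (≢-sym u≢w))

c-as-sum : ∀ {n} (G : Graph n) (π : Partition n) u → c G π u ≡ ∑[ w < n ] ⟦ conflict G π u w ⟧
c-as-sum G π u = length-filter-tabulate (conflict G π u) id

h₂-as-sum : ∀ {n} (G : Graph n) (π : Partition n) → h₂ G π ≡ ∑[ u < n ] (c G π u * c G π u)
h₂-as-sum G π = sum-map-tabulate (λ u → c G π u * c G π u) id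

conflict-sym : ∀ {n} (G : Graph n) (π : Partition n) u w → conflict G π u w ≡ conflict G π w u
conflict-sym G π u w =
  cong₂ (λ d e → not d ∧ e) (does-≟-sym u w)
        (cong₂ _==ᵇ_ (==ᵇ-comm (π u) (π w)) (cong not (Graph.sym G u w)))

conflict-irrefl : ∀ {n} (G : Graph n) (π : Partition n) u → conflict G π u u ≡ false
conflict-irrefl G π u = cong (λ d → not d ∧ _) (dec-true (u ≟ u) refl)

flip-other : ∀ {n} (π : Partition n) {v u} → u ≢ v → flip1 π v u ≡ π u
flip-other π {v} {u} u≢v = cong (λ d → if d then not (π u) else π u) (dec-false (u ≟ v) u≢v)

flip-toggles : ∀ {n} (G : Graph n) (π : Partition n) {v u} (w : Fin n) → u ≢ v →
               conflict G (flip1 π v) u w ≡ does (w ≟ v) xor conflict G π u w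
flip-toggles G π {v} {u} w u≢v with w ≟ v
... | no _ = cong (λ p → not (does (u ≟ w)) ∧ ((p ==ᵇ π w) ==ᵇ not (adj G u w)))
                   (flip-other π u≢v)
... | yes refl rewrite dec-false (u ≟ w) u≢v =
  trans (cong (_==ᵇ r) (==ᵇ-notʳ (π u) (π w))) (==ᵇ-notˡ (π u ==ᵇ π w) r)
  where r = not (adj G u w)

spread : ∀ a b d k → a + b + d ≡ 1 → k ≡ a * k + b * k + d * k
spread a b d k abd≡1 =
  trans (sym (*-identityˡ k)) (trans (cong (_* k) (sym abd≡1)) (distribute a b d k))
  where
  distribute : ∀ a b d k → (a + b + d) * k ≡ a * k + b * k + d * k
  distribute = solve-∀

-- A degree that moves down (a = 1) or up (b = 1) by one changes its square
-- by 2x - 1, resp. 2x + 1.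
square-shift : ∀ a b x y → a + b ≡ 1 → y + a ≡ x + b →
               y * y + 2 * (a * x) ≡ x * x + a + (2 * (b * x) + b)
square-shift zero (suc zero) x y refl y≡x+1 rewrite trans (sym (+-identityʳ y)) y≡x+1 = up x
  where
  up : ∀ x → (x + 1) * (x + 1) + 2 * (0 * x) ≡ x * x + 0 + (2 * (1 * x) + 1)
  up = solve-∀
square-shift (suc zero) zero x y refl y+1≡x rewrite sym (trans y+1≡x (+-identityʳ x)) = down y
  where
  down : ∀ y → y * y + 2 * (1 * (y + 1)) ≡ (y + 1) * (y + 1) + 1 + (2 * (0 * (y + 1)) + 0)
  down = solve-∀
square-shift zero          zero          x y () _
square-shift zero          (suc (suc b)) x y () _
square-shift (suc zero)    (suc b)       x y () _
square-shift (suc (suc a)) b             x y () _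

-- The change of h₂ at the flipped vertex itself: the two squares swap.
energy-at-pivot : ∀ a b d x y → a ≡ 0 → b ≡ 0 → d ≡ 1 →
                  y * y + 2 * (a * x) + d * (x * x) ≡ x * x + a + (2 * (b * x) + b) + d * (y * y)
energy-at-pivot .0 .0 .1 x y refl refl refl = swap x y
  where
  swap : ∀ x y → y * y + 2 * (0 * x) + 1 * (x * x) ≡ x * x + 0 + (2 * (0 * x) + 0) + 1 * (y * y)
  swap = solve-∀

energy-off-pivot : ∀ a b d x y p q → d ≡ 0 → a + b ≡ 1 → y + a ≡ x + b →
                   y * y + 2 * (a * x) + d * p ≡ x * x + a + (2 * (b * x) + b) + d * q
energy-off-pivot a b .0 x y p q refl a+b≡1 shift = cong (_+ 0) (square-shift a b x y a+b≡1 shift)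

indicator-lower : ∀ p x y → ⟦ p ⟧ + ⟦ p ⟧ * y ≤ ⟦ p ⟧ * (x + y + ⟦ p ⟧)
indicator-lower true x y rewrite +-identityʳ y | +-identityʳ (x + y + 1) =
  subst (_≤ x + y + 1) (+-comm y 1) (+-monoˡ-≤ 1 (m≤n+m y x))
indicator-lower false x y = z≤n

weighted-split-≤ : ∀ b x y a k → b * a ≡ 0 → y ≤ k → b * (x + y + a) ≤ b * x + b * k
weighted-split-≤ b x y a k ba≡0 y≤k = begin
    b * (x + y + a)
  ≡⟨ distribute b x y a ⟩
    b * x + b * y + b * a
  ≡⟨ cong (b * x + b * y +_) ba≡0 ⟩
    b * x + b * y + 0
  ≡⟨ +-identityʳ (b * x + b * y) ⟩
    b * x + b * y
  ≤⟨ +-monoʳ-≤ (b * x) (*-monoʳ-≤ b y≤k) ⟩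
    b * x + b * k ∎
  where
  open ≤-Reasoning
  distribute : ∀ b x y a → b * (x + y + a) ≡ b * x + b * y + b * a
  distribute = solve-∀

module FlipAt {n} (G : Graph n) (π : Partition n) (v : Fin n) where

  π′ : Partition n
  π′ = flip1 π v

  inA inB isV : Fin n → ℕ
  inA u = ⟦ conflict G π v u ⟧
  inB u = ⟦ conflict G π′ v u ⟧
  isV u = ⟦ does (u ≟ v) ⟧

  cv m : ℕ
  cv = c G π v
  m  = c G π′ v

  B-is-not-A : ∀ {u} → u ≢ v → conflict G π′ v u ≡ not (conflict G π v u)
  B-is-not-A {u} u≢v = begin
      conflict G π′ v u
    ≡⟨ conflict-sym G π′ v u ⟩
      conflict G π′ u v
    ≡⟨ flip-toggles G π v u≢v ⟩
      does (v ≟ v) xor conflict G π u v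
    ≡⟨ cong₂ _xor_ (dec-true (v ≟ v) refl) (conflict-sym G π u v) ⟩
      not (conflict G π v u) ∎
    where open ≡-Reasoning

  A-or-B : ∀ {u} → u ≢ v → inA u + inB u ≡ 1
  A-or-B {u} u≢v =
    trans (cong (λ b → inA u + ⟦ b ⟧) (B-is-not-A u≢v)) (⟦⟧-complement (conflict G π v u))

  A-B-disjoint : ∀ u → inA u * inB u ≡ 0
  A-B-disjoint u = case u ≟ v of λ where
    (yes refl) → cong (λ a → ⟦ a ⟧ * inB u) (conflict-irrefl G π u)
    (no u≢v)   → trans (cong (λ b → inA u * ⟦ b ⟧) (B-is-not-A u≢v)) (⟦⟧-disjoint (conflict G π v u))

  partition : ∀ u → inA u + inB u + isV u ≡ 1
  partition u = case u ≟ v of λ where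
    (yes refl) → trans (cong₂ (λ a b → ⟦ a ⟧ + ⟦ b ⟧ + isV u) (conflict-irrefl G π u) (conflict-irrefl G π′ u))
                       (cong ⟦_⟧ (dec-true (u ≟ u) refl))
    (no u≢v)   → cong₂ _+_ (A-or-B u≢v) (cong ⟦_⟧ (dec-false (u ≟ v) u≢v))

  sizes : cv + m + 1 ≡ n
  sizes = begin
      cv + m + 1
    ≡⟨ cong₂ _+_ (cong₂ _+_ (c-as-sum G π v) (c-as-sum G π′ v)) (sym (∑-pick v (λ _ → 1))) ⟩
      ∑[ u < n ] inA u + ∑[ u < n ] inB u + ∑[ u < n ] (isV u * 1)
    ≡⟨ sym (∑-distrib-+₃ inA inB (λ u → isV u * 1)) ⟩
      ∑[ u < n ] (inA u + inB u + isV u * 1)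
    ≡⟨ sum-cong-≗ (λ u → trans (cong (inA u + inB u +_) (*-identityʳ (isV u))) (partition u)) ⟩
      ∑[ u < n ] 1
    ≡⟨ ∑-ones n ⟩
      n ∎
    where open ≡-Reasoning

  degree-shift : ∀ {u} → u ≢ v → c G π′ u + inA u ≡ c G π u + inB u
  degree-shift {u} u≢v = begin
      c G π′ u + inA u
    ≡⟨ cong₂ _+_ (trans (c-as-sum G π′ u) (sum-cong-≗ (λ w → cong ⟦_⟧ (flip-toggles G π w u≢v))))
                 (cong ⟦_⟧ (conflict-sym G π v u)) ⟩
      ∑[ w < n ] ⟦ does (w ≟ v) xor conflict G π u w ⟧ + ⟦ conflict G π u v ⟧
    ≡⟨ ∑-toggle v (conflict G π u) ⟩
      ∑[ w < n ] ⟦ conflict G π u w ⟧ + ⟦ not (conflict G π u v) ⟧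
    ≡⟨ cong₂ _+_ (sym (c-as-sum G π u))
                 (cong ⟦_⟧ (trans (cong not (conflict-sym G π u v)) (sym (B-is-not-A u≢v)))) ⟩
      c G π u + inB u ∎
    where open ≡-Reasoning

  energy-term : ∀ u → c G π′ u * c G π′ u + 2 * (inA u * c G π u) + isV u * (cv * cv)
                    ≡ c G π u * c G π u + inA u + (2 * (inB u * c G π u) + inB u) + isV u * (m * m)
  energy-term u = case u ≟ v of λ where
    (yes refl) → energy-at-pivot _ _ _ cv m (cong ⟦_⟧ (conflict-irrefl G π u))
                   (cong ⟦_⟧ (conflict-irrefl G π′ u)) (cong ⟦_⟧ (dec-true (u ≟ u) refl))
    (no u≢v)   → energy-off-pivot _ _ _ (c G π u) (c G π′ u) (cv * cv) (m * m)
                   (cong ⟦_⟧ (dec-false (u ≟ v) u≢v)) (A-or-B u≢v) (degree-shift u≢v)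

  SA SB : ℕ
  SA = ∑[ u < n ] (inA u * c G π u)
  SB = ∑[ u < n ] (inB u * c G π u)

  flip-energy : h₂ G π′ + 2 * SA + cv * cv ≡ h₂ G π + cv + (2 * SB + m) + m * m
  flip-energy = begin
      h₂ G π′ + 2 * SA + cv * cv
    ≡⟨ cong₂ _+_ (cong₂ _+_ (h₂-as-sum G π′) (*-distribˡ-sum 2 (λ u → inA u * c G π u)))
                 (sym (∑-pick v (λ _ → cv * cv))) ⟩
      ∑[ u < n ] f₁ u + ∑[ u < n ] f₂ u + ∑[ u < n ] f₃ u
    ≡⟨ sym (∑-distrib-+₃ f₁ f₂ f₃) ⟩
      ∑[ u < n ] (f₁ u + f₂ u + f₃ u)
    ≡⟨ sum-cong-≗ energy-term ⟩
      ∑[ u < n ] (g₁ u + g₂ u + g₃ u + g₄ u)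
    ≡⟨ trans (∑-distrib-+ (λ u → g₁ u + g₂ u + g₃ u) g₄)
             (cong (_+ ∑[ u < n ] g₄ u) (∑-distrib-+₃ g₁ g₂ g₃)) ⟩
      ∑[ u < n ] g₁ u + ∑[ u < n ] g₂ u + ∑[ u < n ] g₃ u + ∑[ u < n ] g₄ u
    ≡⟨ cong₂ _+_ (cong₂ _+_ (cong₂ _+_ (sym (h₂-as-sum G π)) (sym (c-as-sum G π v))) B-part)
                 (∑-pick v (λ _ → m * m)) ⟩
      h₂ G π + cv + (2 * SB + m) + m * m ∎
    where
    open ≡-Reasoning
    f₁ f₂ f₃ g₁ g₂ g₃ g₄ : Fin n → ℕ
    f₁ u = c G π′ u * c G π′ u
    f₂ u = 2 * (inA u * c G π u)
    f₃ u = isV u * (cv * cv)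
    g₁ u = c G π u * c G π u
    g₂ u = inA u
    g₃ u = 2 * (inB u * c G π u) + inB u
    g₄ u = isV u * (m * m)
    B-part : ∑[ u < n ] g₃ u ≡ 2 * SB + m
    B-part = trans (∑-distrib-+ (λ u → 2 * (inB u * c G π u)) inB)
                   (cong₂ _+_ (sym (*-distribˡ-sum 2 (λ u → inB u * c G π u))) (sym (c-as-sum G π′ v)))

  toA toB : Fin n → ℕ
  toA u = ∑[ w < n ] (inA w * ⟦ conflict G π u w ⟧)
  toB u = ∑[ w < n ] (inB w * ⟦ conflict G π u w ⟧)

  -- Every conflict of u is with A, with B, or with v (the latter iff u ∈ A).
  conflicts-split : ∀ u → c G π u ≡ toA u + toB u + inA u
  conflicts-split u = begin
      c G π u
    ≡⟨ c-as-sum G π u ⟩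
      ∑[ w < n ] ⟦ conflict G π u w ⟧
    ≡⟨ sum-cong-≗ (λ w → spread (inA w) (inB w) (isV w) ⟦ conflict G π u w ⟧ (partition w)) ⟩
      ∑[ w < n ] (inA w * ⟦ conflict G π u w ⟧ + inB w * ⟦ conflict G π u w ⟧ + isV w * ⟦ conflict G π u w ⟧)
    ≡⟨ ∑-distrib-+₃ (λ w → inA w * ⟦ conflict G π u w ⟧) (λ w → inB w * ⟦ conflict G π u w ⟧)
                    (λ w → isV w * ⟦ conflict G π u w ⟧) ⟩
      toA u + toB u + ∑[ w < n ] (isV w * ⟦ conflict G π u w ⟧)
    ≡⟨ cong (toA u + toB u +_) (trans (∑-pick v (⟦_⟧ ∘ conflict G π u)) (cong ⟦_⟧ (conflict-sym G π u v))) ⟩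
      toA u + toB u + inA u ∎
    where open ≡-Reasoning

  crossing-symmetric : ∑[ u < n ] (inA u * toB u) ≡ ∑[ w < n ] (inB w * toA w)
  crossing-symmetric = begin
      ∑[ u < n ] (inA u * toB u)
    ≡⟨ sum-cong-≗ (λ u → *-distribˡ-sum (inA u) (λ w → inB w * ⟦ conflict G π u w ⟧)) ⟩
      ∑[ u < n ] ∑[ w < n ] (inA u * (inB w * ⟦ conflict G π u w ⟧))
    ≡⟨ ∑-comm (λ u w → inA u * (inB w * ⟦ conflict G π u w ⟧)) ⟩
      ∑[ w < n ] ∑[ u < n ] (inA u * (inB w * ⟦ conflict G π u w ⟧))
    ≡⟨ sum-cong-≗ (λ w → sum-cong-≗ (λ u →
         trans (x∙yz≈y∙xz (inA u) (inB w) _)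
               (cong (λ b → inB w * (inA u * ⟦ b ⟧)) (conflict-sym G π u w)))) ⟩
      ∑[ w < n ] ∑[ u < n ] (inB w * (inA u * ⟦ conflict G π w u ⟧))
    ≡⟨ sum-cong-≗ (λ w → sym (*-distribˡ-sum (inB w) (λ u → inA u * ⟦ conflict G π w u ⟧))) ⟩
      ∑[ w < n ] (inB w * toA w) ∎
    where open ≡-Reasoning

  X : ℕ
  X = ∑[ u < n ] (inA u * toB u)

  -- Each u ∈ A conflicts with v and with all its partners in B.
  A-degrees-lower : cv + X ≤ SA
  A-degrees-lower = begin
      cv + X
    ≡⟨ cong (_+ X) (c-as-sum G π v) ⟩
      ∑[ u < n ] inA u + X
    ≡⟨ sym (∑-distrib-+ inA (λ u → inA u * toB u)) ⟩
      ∑[ u < n ] (inA u + inA u * toB u)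
    ≤⟨ ∑-mono-≤ (λ u → subst (λ k → inA u + inA u * toB u ≤ inA u * k) (sym (conflicts-split u))
                             (indicator-lower (conflict G π v u) (toA u) (toB u))) ⟩
      SA ∎
    where open ≤-Reasoning

  -- Each u ∈ B has no conflict with v and at most m = |B| conflicts inside B.
  B-degrees-upper : SB ≤ X + m * m
  B-degrees-upper = begin
      SB
    ≤⟨ ∑-mono-≤ (λ u → subst (λ k → inB u * k ≤ inB u * toA u + inB u * m) (sym (conflicts-split u))
         (weighted-split-≤ (inB u) (toA u) (toB u) (inA u) m
           (trans (*-comm (inB u) (inA u)) (A-B-disjoint u)) (toB≤m u))) ⟩
      ∑[ u < n ] (inB u * toA u + inB u * m)
    ≡⟨ ∑-distrib-+ (λ u → inB u * toA u) (λ u → inB u * m) ⟩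
      ∑[ u < n ] (inB u * toA u) + ∑[ u < n ] (inB u * m)
    ≡⟨ cong₂ _+_ (sym crossing-symmetric)
                 (trans (sym (*-distribʳ-sum m inB)) (cong (_* m) (sym (c-as-sum G π′ v)))) ⟩
      X + m * m ∎
    where
    open ≤-Reasoning
    toB≤m : ∀ u → toB u ≤ m
    toB≤m u = subst (toB u ≤_) (sym (c-as-sum G π′ v)) (∑-≤-weights inB (conflict G π u))

key-inequality : ∀ {h h′ SA SB X x m} → h ≤ h′ →
                 h′ + 2 * SA + x * x ≡ h + x + (2 * SB + m) + m * m →
                 x + X ≤ SA → SB ≤ X + m * m →
                 x * x + x ≤ 3 * (m * m) + m
key-inequality {h} {h′} {SA} {SB} {X} {x} {m} h≤h′ energy lower upper =
  +-cancelˡ-≤ x _ _ (+-cancelˡ-≤ (h + 2 * X) _ _ (begin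
      (h + 2 * X) + (x + (x * x + x))
    ≡⟨ regroupˡ h X x ⟩
      h + 2 * (x + X) + x * x
    ≤⟨ +-monoˡ-≤ (x * x) (+-mono-≤ h≤h′ (*-monoʳ-≤ 2 lower)) ⟩
      h′ + 2 * SA + x * x
    ≡⟨ energy ⟩
      h + x + (2 * SB + m) + m * m
    ≤⟨ +-monoˡ-≤ (m * m) (+-monoʳ-≤ (h + x) (+-monoˡ-≤ m (*-monoʳ-≤ 2 upper))) ⟩
      h + x + (2 * (X + m * m) + m) + m * m
    ≡⟨ regroupʳ h X x m ⟩
      (h + 2 * X) + (x + (3 * (m * m) + m)) ∎))
  where
  open ≤-Reasoning
  regroupˡ : ∀ h X x → (h + 2 * X) + (x + (x * x + x)) ≡ h + 2 * (x + X) + x * x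
  regroupˡ = solve-∀
  regroupʳ : ∀ h X x m → h + x + (2 * (X + m * m) + m) + m * m ≡ (h + 2 * X) + (x + (3 * (m * m) + m))
  regroupʳ = solve-∀

-- x² + x ≤ 3m² + m forces x ≤ 2m, since (2m+1)² + (2m+1) > 3m² + m.
at-most-double : ∀ x m → x * x + x ≤ 3 * (m * m) + m → x ≤ 2 * m
at-most-double x m bound with x ≤? 2 * m
... | yes x≤2m = x≤2m
... | no  x≰2m = ⊥-elim (<⇒≱ too-big bound)
  where
  2m+1≤x : suc (2 * m) ≤ x
  2m+1≤x = ≰⇒> x≰2m
  expand : ∀ m → suc (3 * (m * m) + m + (m * m + 5 * m + 1)) ≡ suc (2 * m) * suc (2 * m) + suc (2 * m)
  expand = solve-∀
  too-big : 3 * (m * m) + m < x * x + x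
  too-big = <-≤-trans (subst (3 * (m * m) + m <_) (expand m) (s≤s (m≤m+n (3 * (m * m) + m) _)))
                      (+-mono-≤ (*-mono-≤ 2m+1≤x 2m+1≤x) 2m+1≤x)

-- If x ≤ 2m then 2x² ≤ x² + 2xm ≤ (x + m)² ≤ (x + m + 1)(x + m).
double-square-bound : ∀ x m → x ≤ 2 * m → 2 * (x * x) ≤ suc (x + m) * (x + m)
double-square-bound x m x≤2m = begin
    2 * (x * x)
  ≡⟨ twice (x * x) ⟩
    x * x + x * x
  ≤⟨ +-monoʳ-≤ (x * x) (*-monoʳ-≤ x x≤2m) ⟩
    x * x + x * (2 * m)
  ≤⟨ m≤m+n _ (m * m) ⟩
    x * x + x * (2 * m) + m * m
  ≡⟨ binomial x m ⟩
    (x + m) * (x + m)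
  ≤⟨ *-monoˡ-≤ (x + m) (n≤1+n (x + m)) ⟩
    suc (x + m) * (x + m) ∎
  where
  open ≤-Reasoning
  twice : ∀ y → 2 * y ≡ y + y
  twice = solve-∀
  binomial : ∀ x m → x * x + x * (2 * m) + m * m ≡ (x + m) * (x + m)
  binomial = solve-∀

lemma11 : (n : ℕ) (G : Graph n) (π : Partition n) →
          (∀ v → h₂ G π ≤ h₂ G (flip1 π v)) →
          ∀ v → 2 * (c G π v * c G π v) ≤ n * (n ∸ 1)
lemma11 n G π locally-optimal v =
  subst (λ k → 2 * (cv * cv) ≤ k * (k ∸ 1)) (trans (+-comm 1 (cv + m)) sizes)
        (double-square-bound cv m (at-most-double cv m
          (key-inequality (locally-optimal v) flip-energy A-degrees-lower B-degrees-upper)))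
  where open FlipAt G π v
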